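{- Let $n\in\mathbb{N}$ and let $K_{1,n}$ be the star with center $r$, leaves $v_0,\dots,v_{n-1}$, and edges $i=rv_i$ for $0\leq i<n$. Let $S=\{\{v_i,v_j\}:0\leq i<j<n\}$. Then the inequality $\sum_{e\in E(K_{1,n})}x_e\geq n-1$ defines a shared facet of $\mathrm{MultC}(K_{1,n},S)$.
   Context: Given a graph $G=(V,E)$ and $S\subseteq\binom{V}{2}$, an ($S$-)multicut is a set $\delta\subseteq E$ such that for every $\{s,t\}\in S$ the nodes $s$ and $t$ lie in different components of $G-\delta$. For $F\subseteq E$, $x^F\in\mathbb{R}^E$ is its incidence vector. The multicut polytope is $\mathrm{MultC}^{\square}(G,S)=\mathrm{conv}\{x^\delta:\delta\text{ an } S\text{ -multicut}\}$ and the multicut dominant is $\mathrm{MultC}(G,S)=\mathrm{MultC}^{\square}(G,S)+\mathbb{R}^E_{\geq 0}$. A facet-defining inequality of $\mathrm{MultC}(G,S)$ defines a shared facet if it is also facet-defining for $\mathrm{MultC}^{\square}(G,S)$.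
   Formalization: The multicut polytope and the multicut dominant are taken in ℚ^E instead of ℝ^E, so validity and the dimension counts in the shared-facet condition range over rational points. -}

module Defs where

open import Data.Nat using (ℕ; zero; suc)
open import Data.Fin using (Fin; zero; suc; toℕ)
open import Data.Bool using (Bool; true; false; if_then_else_)
open import Data.Product using (Σ; _×_; _,_; ∃; ∃-syntax; proj₁; proj₂)
open import Data.Sum using (_⊎_)
open import Data.Integer using (+_)
open import Data.Rational using (ℚ; 0ℚ; 1ℚ; _+_; _*_; _-_; _≤_; _/_)
open import Relation.Binary.PropositionalEquality using (_≡_)
open import Relation.Nullary using (¬_)
import Data.Nat as ℕ

Σℚ : {k : ℕ} → (Fin k → ℚ) → ℚ
Σℚ {zero}  f = 0ℚ
Σℚ {suc k} f = f zero + Σℚ (λ i → f (suc i))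

Vecℚ : ℕ → Set
Vecℚ d = Fin d → ℚ

PointSet : ℕ → Set₁
PointSet d = Vecℚ d → Set

record Graph : Set where
  field
    nV   : ℕ
    nE   : ℕ
    ends : Fin nE → Fin nV × Fin nV
open Graph public

EdgeSet : Graph → Set
EdgeSet G = Fin (nE G) → Bool

incidence : (G : Graph) → EdgeSet G → Vecℚ (nE G)
incidence G F e = if F e then 1ℚ else 0ℚ

-- u and w lie in the same connected component of G - δ
-- (paths only use edges e with δ e ≡ false)
data SameComp (G : Graph) (δ : EdgeSet G) (u : Fin (nV G)) : Fin (nV G) → Set where
  here : SameComp G δ u u
  step : ∀ {v w} → SameComp G δ u v → (e : Fin (nE G)) → δ e ≡ false →
         (ends G e ≡ (v , w)) ⊎ (ends G e ≡ (w , v)) → SameComp G δ u w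

-- terminal pairs S ⊆ (V choose 2), given as a relation on vertices
Terminals : Graph → Set₁
Terminals G = Fin (nV G) → Fin (nV G) → Set

IsMulticut : (G : Graph) → Terminals G → EdgeSet G → Set
IsMulticut G S δ = ∀ s t → S s t → ¬ SameComp G δ s t

MultCbox : (G : Graph) → Terminals G → PointSet (nE G)
MultCbox G S x =
  Σ ℕ λ k → Σ (Fin k → ℚ) λ λs → Σ (Fin k → EdgeSet G) λ δs →
    (∀ i → 0ℚ ≤ λs i) × (Σℚ λs ≡ 1ℚ) × (∀ i → IsMulticut G S (δs i)) ×
    (∀ e → x e ≡ Σℚ (λ i → λs i * incidence G (δs i) e))

MultC : (G : Graph) → Terminals G → PointSet (nE G)
MultC G S x = Σ (Vecℚ (nE G)) λ y → MultCbox G S y × (∀ e → y e ≤ x e)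

AffIndep : {d m : ℕ} → (Fin m → Vecℚ d) → Set
AffIndep {d} {m} p = (c : Fin m → ℚ) → Σℚ c ≡ 0ℚ →
  (∀ e → Σℚ (λ i → c i * p i e) ≡ 0ℚ) → ∀ i → c i ≡ 0ℚ

HasAffIndep : {d : ℕ} → PointSet d → ℕ → Set
HasAffIndep {d} P m = Σ (Fin m → Vecℚ d) λ p → (∀ i → P (p i)) × AffIndep p

-- P has exactly m affinely independent points at most, i.e. dim P = m - 1
-- (m = 0 means P = ∅, of dimension -1)
MaxAffIndep : {d : ℕ} → PointSet d → ℕ → Set
MaxAffIndep P m = HasAffIndep P m × ¬ HasAffIndep P (suc m)

dot : {d : ℕ} → Vecℚ d → Vecℚ d → ℚ
dot a x = Σℚ (λ e → a e * x e)

Face : {d : ℕ} → PointSet d → Vecℚ d → ℚ → PointSet d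
Face P a β x = P x × dot a x ≡ β

FacetDefining : {d : ℕ} → PointSet d → Vecℚ d → ℚ → Set
FacetDefining P a β =
  (∀ x → P x → β ≤ dot a x) ×
  Σ ℕ λ m → MaxAffIndep (Face P a β) m × MaxAffIndep P (suc m)

SharedFacet : (G : Graph) → Terminals G → Vecℚ (nE G) → ℚ → Set
SharedFacet G S a β = FacetDefining (MultC G S) a β × FacetDefining (MultCbox G S) a β

-- The star K_{1,n}: vertex 0 = center r, vertex suc i = leaf v_i,
-- edge i = r v_i.

star : ℕ → Graph
star n = record { nV = suc n ; nE = n ; ends = λ i → (zero , suc i) }

starTerminals : (n : ℕ) → Terminals (star n)
starTerminals n s t = Σ (Fin n) λ i → Σ (Fin n) λ j →
  (toℕ i ℕ.< toℕ j) × (s ≡ suc i) × (t ≡ suc j)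

-- n - 1 as a rational (equal to -1 when n = 0)
nMinus1 : ℕ → ℚ
nMinus1 n = (+ n / 1) - 1ℚ

-- A multicut of the star leaves at most one edge uncut, since two uncut edges would join two
-- leaves through the centre; conversely every such edge set is a multicut. Hence x(E) ≥ n - 1 at
-- every multicut vector, so on the convex hull and on its dominant. The n multicuts E ∖ {i} are affinely
-- independent points of the face, and together with E they give n + 1 affinely independent points
-- of both polyhedra. The matching upper bounds (n + 2 points of ℚⁿ, or n + 1 points of a hyperplane
-- in ℚⁿ, are affinely dependent) follow by Gaussian elimination over ℚ.
module Submission where

open import Defs
open import Algebra.Bundles using (CommutativeRing)
open import Data.Bool using (true; false; not; if_then_else_)
open import Data.Bool.Properties using (¬-not) renaming (_≟_ to _≟ᵇ_)
open import Data.Fin using (Fin; zero; suc; punchIn)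
open import Data.Fin.Properties using (_≟_; <-cmp; <⇒≢; suc-injective; all?; any?; ¬∀⟶∃¬)
import Data.Integer as ℤ
import Data.Integer.Properties as ℤ
open import Data.Nat using (ℕ; zero; suc; s≤s)
import Data.Nat as ℕ
import Data.Nat.Properties as ℕ
open import Data.Product using (Σ; _×_; _,_; ∃; proj₁; proj₂)
open import Data.Rational
  using (ℚ; 0ℚ; 1ℚ; _+_; _*_; _-_; -_; _≤_; _/_; 1/_; ≢-nonZero; nonNegative; toℚᵘ; *≤*)
open import Data.Rational.Properties
  using ( +-*-commutativeRing; toℚᵘ-injective; toℚᵘ-fromℚᵘ; toℚᵘ-homo-+
        ; +-identityˡ; +-identityʳ; +-inverseʳ; *-comm; *-assoc; *-identityˡ; *-identityʳ
        ; *-zeroˡ; *-zeroʳ; *-inverseˡ; ≤-refl; ≤-reflexive; ≤-trans; +-mono-≤; +-monoʳ-≤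
        ; *-monoˡ-≤-nonNeg; module ≤-Reasoning)
  renaming (_≟_ to _≟ℚ_)
import Data.Rational.Unnormalised as ℚᵘ
import Data.Rational.Unnormalised.Properties as ℚᵘ
open import Data.Rational.Solver using (module +-*-Solver)
open import Data.Sum using (_⊎_; inj₁; inj₂)
open import Data.Vec.Functional using (_∷_; insertAt; removeAt)
open import Data.Vec.Functional.Properties using (insertAt-lookup; insertAt-punchIn)
open import Function using (_∘_)
open import Relation.Binary.Definitions using (tri<; tri≈; tri>)
open import Relation.Binary.PropositionalEquality
open import Relation.Nullary using (¬_; yes; no; does; contradiction)

open import Algebra.Properties.Semiring.Sum (CommutativeRing.semiring +-*-commutativeRing)
  using (sum; sum-cong-≗; ∑-distrib-+; ∑-comm; *-distribˡ-sum; sum-remove)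
open +-*-Solver using (solve; _:+_; _:*_; :-_; _:-_; _:=_; con)

private
  variable
    d k n : ℕ

0≤1 : 0ℚ ≤ 1ℚ
0≤1 = *≤* (ℤ.+≤+ ℕ.z≤n)

+[1+n]/1≡1+n/1 : (n : ℕ) → ℤ.+ suc n / 1 ≡ 1ℚ + ℤ.+ n / 1
+[1+n]/1≡1+n/1 n = toℚᵘ-injective (begin
    toℚᵘ (ℤ.+ suc n / 1)            ≈⟨ toℚᵘ-fromℚᵘ (ℚᵘ.mkℚᵘ (ℤ.+ suc n) 0) ⟩
    ℚᵘ.mkℚᵘ (ℤ.+ suc n) 0           ≈⟨ ℚᵘ.*≡* (trans (ℤ.*-identityʳ _) (sym (trans (ℤ.*-identityʳ _)
                                        (cong (λ z → ℤ.+ 1 ℤ.+ z) (ℤ.*-identityʳ (ℤ.+ n)))))) ⟩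
    toℚᵘ 1ℚ ℚᵘ.+ ℚᵘ.mkℚᵘ (ℤ.+ n) 0  ≈⟨ ℚᵘ.+-congʳ (toℚᵘ 1ℚ) (toℚᵘ-fromℚᵘ (ℚᵘ.mkℚᵘ (ℤ.+ n) 0)) ⟨
    toℚᵘ 1ℚ ℚᵘ.+ toℚᵘ (ℤ.+ n / 1)   ≈⟨ toℚᵘ-homo-+ 1ℚ (ℤ.+ n / 1) ⟨
    toℚᵘ (1ℚ + ℤ.+ n / 1)           ∎)
  where open ℚᵘ.≃-Reasoning

nMinus1≤n : ∀ n → nMinus1 n ≤ ℤ.+ n / 1
nMinus1≤n n = ≤-trans (+-monoʳ-≤ (ℤ.+ n / 1) (*≤* ℤ.-≤+)) (≤-reflexive (+-identityʳ (ℤ.+ n / 1)))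

*-cancelˡ-≡0 : ∀ {a b} → ¬ a ≡ 0ℚ → a * b ≡ 0ℚ → b ≡ 0ℚ
*-cancelˡ-≡0 {a} {b} a≢0 ab≡0 = begin
  b                ≡⟨ sym (*-identityˡ b) ⟩
  1ℚ * b           ≡⟨ cong (_* b) (*-inverseˡ a) ⟨
  (1/ a * a) * b   ≡⟨ *-assoc (1/ a) a b ⟩
  1/ a * (a * b)   ≡⟨ cong (1/ a *_) ab≡0 ⟩
  1/ a * 0ℚ        ≡⟨ *-zeroʳ (1/ a) ⟩
  0ℚ               ∎
  where
  open ≡-Reasoning
  instance _ = ≢-nonZero a≢0

Σℚ≡sum : (f : Fin k → ℚ) → Σℚ f ≡ sum f
Σℚ≡sum {zero}  f = refl
Σℚ≡sum {suc k} f = cong (f zero +_) (Σℚ≡sum (f ∘ suc))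

Σℚ-cong : {f g : Fin k → ℚ} → (∀ i → f i ≡ g i) → Σℚ f ≡ Σℚ g
Σℚ-cong {f = f} {g} f≗g = trans (Σℚ≡sum f) (trans (sum-cong-≗ f≗g) (sym (Σℚ≡sum g)))

Σℚ-zero : {f : Fin k → ℚ} → (∀ i → f i ≡ 0ℚ) → Σℚ f ≡ 0ℚ
Σℚ-zero {zero}  f≗0 = refl
Σℚ-zero {suc k} f≗0 = trans (cong₂ _+_ (f≗0 zero) (Σℚ-zero (f≗0 ∘ suc))) (+-identityˡ 0ℚ)

Σℚ-distrib-+ : (f g : Fin k → ℚ) → Σℚ (λ i → f i + g i) ≡ Σℚ f + Σℚ g
Σℚ-distrib-+ f g = begin
  Σℚ (λ i → f i + g i)  ≡⟨ Σℚ≡sum (λ i → f i + g i) ⟩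
  sum (λ i → f i + g i) ≡⟨ ∑-distrib-+ f g ⟩
  sum f + sum g         ≡⟨ cong₂ _+_ (Σℚ≡sum f) (Σℚ≡sum g) ⟨
  Σℚ f + Σℚ g           ∎
  where open ≡-Reasoning

Σℚ-*ˡ : (a : ℚ) (f : Fin k → ℚ) → Σℚ (λ i → a * f i) ≡ a * Σℚ f
Σℚ-*ˡ a f = begin
  Σℚ (λ i → a * f i)  ≡⟨ Σℚ≡sum (λ i → a * f i) ⟩
  sum (λ i → a * f i) ≡⟨ *-distribˡ-sum a f ⟨
  a * sum f           ≡⟨ cong (a *_) (Σℚ≡sum f) ⟨
  a * Σℚ f            ∎
  where open ≡-Reasoning

Σℚ-*ʳ : (a : ℚ) (f : Fin k → ℚ) → Σℚ (λ i → f i * a) ≡ Σℚ f * a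
Σℚ-*ʳ a f = trans (Σℚ-cong (λ i → *-comm (f i) a)) (trans (Σℚ-*ˡ a f) (*-comm a (Σℚ f)))

Σℚ-comm : (f : Fin k → Fin n → ℚ) → Σℚ (λ i → Σℚ (f i)) ≡ Σℚ (λ j → Σℚ (λ i → f i j))
Σℚ-comm f = begin
  Σℚ (λ i → Σℚ (f i))              ≡⟨ Σℚ²≡sum² f ⟩
  sum (λ i → sum (f i))            ≡⟨ ∑-comm f ⟩
  sum (λ j → sum (λ i → f i j))    ≡⟨ Σℚ²≡sum² (λ j i → f i j) ⟨
  Σℚ (λ j → Σℚ (λ i → f i j))      ∎
  where
  open ≡-Reasoning
  Σℚ²≡sum² : ∀ {k n} (g : Fin k → Fin n → ℚ) → Σℚ (λ i → Σℚ (g i)) ≡ sum (λ i → sum (g i))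
  Σℚ²≡sum² g = trans (Σℚ-cong (λ i → Σℚ≡sum (g i))) (Σℚ≡sum (λ i → sum (g i)))

Σℚ-removeAt : (f : Fin (suc k) → ℚ) (j : Fin (suc k)) → Σℚ f ≡ f j + Σℚ (removeAt f j)
Σℚ-removeAt f j = begin
  Σℚ f                       ≡⟨ Σℚ≡sum f ⟩
  sum f                      ≡⟨ sum-remove f ⟩
  f j + sum (removeAt f j)   ≡⟨ cong (f j +_) (Σℚ≡sum (removeAt f j)) ⟨
  f j + Σℚ (removeAt f j)    ∎
  where open ≡-Reasoning

Σℚ-mono-≤ : {f g : Fin k → ℚ} → (∀ i → f i ≤ g i) → Σℚ f ≤ Σℚ g
Σℚ-mono-≤ {zero}  f≤g = ≤-refl
Σℚ-mono-≤ {suc k} f≤g = +-mono-≤ (f≤g zero) (Σℚ-mono-≤ (f≤g ∘ suc))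

Σℚ-1 : ∀ n → Σℚ {n} (λ _ → 1ℚ) ≡ ℤ.+ n / 1
Σℚ-1 zero    = refl
Σℚ-1 (suc n) = trans (cong (1ℚ +_) (Σℚ-1 n)) (sym (+[1+n]/1≡1+n/1 n))

dot-cong : (a : Vecℚ d) {x y : Vecℚ d} → (∀ e → x e ≡ y e) → dot a x ≡ dot a y
dot-cong a x≗y = Σℚ-cong (λ e → cong (a e *_) (x≗y e))

dot-combination : (a : Vecℚ d) (c : Fin k → ℚ) (y : Fin k → Vecℚ d) →
                  dot a (λ e → Σℚ (λ i → c i * y i e)) ≡ Σℚ (λ i → c i * dot a (y i))
dot-combination a c y = begin
  Σℚ (λ e → a e * Σℚ (λ i → c i * y i e))    ≡⟨ Σℚ-cong (λ e → sym (Σℚ-*ˡ (a e) (λ i → c i * y i e))) ⟩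
  Σℚ (λ e → Σℚ (λ i → a e * (c i * y i e)))  ≡⟨ Σℚ-comm (λ e i → a e * (c i * y i e)) ⟩
  Σℚ (λ i → Σℚ (λ e → a e * (c i * y i e)))  ≡⟨ Σℚ-cong (λ i → Σℚ-cong (λ e → swap (a e) (c i) (y i e))) ⟩
  Σℚ (λ i → Σℚ (λ e → c i * (a e * y i e)))  ≡⟨ Σℚ-cong (λ i → Σℚ-*ˡ (c i) (λ e → a e * y i e)) ⟩
  Σℚ (λ i → c i * dot a (y i))               ∎
  where
  open ≡-Reasoning
  swap : ∀ x y z → x * (y * z) ≡ y * (x * z)
  swap = solve 3 (λ x y z → x :* (y :* z) := y :* (x :* z)) refl

LinearlyDependent : (Fin k → Vecℚ d) → Set
LinearlyDependent {k} v = Σ (Fin k → ℚ) λ c →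
  (∀ e → Σℚ (λ i → c i * v i e) ≡ 0ℚ) × ∃ λ i → ¬ c i ≡ 0ℚ

AffinelyDependent : (Fin k → Vecℚ d) → Set
AffinelyDependent {k} p = Σ (Fin k → ℚ) λ c →
  Σℚ c ≡ 0ℚ × (∀ e → Σℚ (λ i → c i * p i e) ≡ 0ℚ) × ∃ λ i → ¬ c i ≡ 0ℚ

affinelyDependent⇒¬AffIndep : {p : Fin k → Vecℚ d} → AffinelyDependent p → ¬ AffIndep p
affinelyDependent⇒¬AffIndep (c , Σc≡0 , comb≡0 , i , cᵢ≢0) indep = cᵢ≢0 (indep c Σc≡0 comb≡0 i)

eliminate : (v : Fin (suc k) → Vecℚ (suc d)) (j : Fin (suc k)) (r : Fin k → ℚ) → Fin k → Vecℚ d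
eliminate v j r i e = v (punchIn j i) (suc e) - r i * v j (suc e)

-- One step of Gaussian elimination, with pivot v j: a dependency c′ among the reduced vectors
-- lifts to v by giving v j the coefficient -Σ c′ᵢ rᵢ.
linearlyDependent-eliminate : (v : Fin (suc k) → Vecℚ (suc d)) (j : Fin (suc k)) (r : Fin k → ℚ) →
  (∀ i → v (punchIn j i) zero ≡ r i * v j zero) →
  LinearlyDependent (eliminate v j r) → LinearlyDependent v
linearlyDependent-eliminate {k = k} {d = d} v j r column₀ (c′ , comb′≡0 , i , c′ᵢ≢0) =
  c , comb≡0 , punchIn j i , λ cᵢ≡0 → c′ᵢ≢0 (trans (sym (insertAt-punchIn c′ j (- S) i)) cᵢ≡0)
  where
  S = Σℚ (λ i → c′ i * r i)
  c = insertAt c′ j (- S)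
  w : Fin k → Vecℚ (suc d)
  w i e = v (punchIn j i) e - r i * v j e

  comb≡comb′ : ∀ e → Σℚ (λ x → c x * v x e) ≡ Σℚ (λ i → c′ i * w i e)
  comb≡comb′ e = begin
    Σℚ (λ x → c x * v x e)
      ≡⟨ Σℚ-removeAt (λ x → c x * v x e) j ⟩
    c j * v j e + Σℚ (λ i → c (punchIn j i) * v (punchIn j i) e)
      ≡⟨ cong₂ _+_ (cong (_* v j e) (insertAt-lookup c′ j (- S)))
                   (Σℚ-cong (λ i → cong (_* v (punchIn j i) e) (insertAt-punchIn c′ j (- S) i))) ⟩
    - S * v j e + Σℚ (λ i → c′ i * v (punchIn j i) e)
      ≡⟨ cong (- S * v j e +_) (Σℚ-cong (λ i → split (c′ i) (v (punchIn j i) e) (r i) (v j e))) ⟩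
    - S * v j e + Σℚ (λ i → c′ i * w i e + c′ i * r i * v j e)
      ≡⟨ cong (- S * v j e +_) (trans (Σℚ-distrib-+ (λ i → c′ i * w i e) (λ i → c′ i * r i * v j e))
                                        (cong (Σℚ (λ i → c′ i * w i e) +_) (Σℚ-*ʳ (v j e) (λ i → c′ i * r i)))) ⟩
    - S * v j e + (Σℚ (λ i → c′ i * w i e) + S * v j e)
      ≡⟨ cancel S (v j e) _ ⟩
    Σℚ (λ i → c′ i * w i e)
      ∎
    where
    open ≡-Reasoning
    split : ∀ a x ρ y → a * x ≡ a * (x - ρ * y) + a * ρ * y
    split = solve 4 (λ a x ρ y → a :* x := a :* (x :- ρ :* y) :+ a :* ρ :* y) refl
    cancel : ∀ s y t → - s * y + (t + s * y) ≡ t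
    cancel = solve 3 (λ s y t → (:- s) :* y :+ (t :+ s :* y) := t) refl

  comb≡0 : ∀ e → Σℚ (λ x → c x * v x e) ≡ 0ℚ
  comb≡0 zero    = trans (comb≡comb′ zero)
    (Σℚ-zero (λ i → trans (cong (λ z → c′ i * (z - r i * v j zero)) (column₀ i))
                          (trans (cong (c′ i *_) (+-inverseʳ (r i * v j zero))) (*-zeroʳ (c′ i)))))
  comb≡0 (suc e) = trans (comb≡comb′ (suc e)) (comb′≡0 e)

d<k⇒linearlyDependent : d ℕ.< k → (v : Fin k → Vecℚ d) → LinearlyDependent v
d<k⇒linearlyDependent {zero} (s≤s _) v = (λ _ → 1ℚ) , (λ ()) , zero , λ ()
d<k⇒linearlyDependent {suc d} (s≤s d<k) v with all? (λ j → v j zero ≟ℚ 0ℚ)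
... | yes column₀≡0 =
  linearlyDependent-eliminate v zero (λ _ → 0ℚ)
    (λ i → trans (column₀≡0 (suc i)) (sym (*-zeroˡ (v zero zero))))
    (d<k⇒linearlyDependent d<k _)
... | no column₀≢0 with ¬∀⟶∃¬ _ _ (λ j → v j zero ≟ℚ 0ℚ) column₀≢0
...   | j , pivot≢0 =
  linearlyDependent-eliminate v j r column₀ (d<k⇒linearlyDependent d<k _)
  where
  instance _ = ≢-nonZero pivot≢0
  r : Fin _ → ℚ
  r i = v (punchIn j i) zero * 1/ v j zero
  column₀ : ∀ i → v (punchIn j i) zero ≡ r i * v j zero
  column₀ i = sym (trans (*-assoc (v (punchIn j i) zero) _ _)
                  (trans (cong (v (punchIn j i) zero *_) (*-inverseˡ (v j zero)))
                         (*-identityʳ _)))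

-- Lifting p i to (1 , p i) turns linear into affine dependence.
1+d<k⇒affinelyDependent : suc d ℕ.< k → (p : Fin k → Vecℚ d) → AffinelyDependent p
1+d<k⇒affinelyDependent d+1<k p with d<k⇒linearlyDependent d+1<k (λ i → 1ℚ ∷ p i)
... | c , comb≡0 , i , cᵢ≢0 =
  c , trans (Σℚ-cong (λ i → sym (*-identityʳ (c i)))) (comb≡0 zero) , comb≡0 ∘ suc , i , cᵢ≢0

-- The tails of points on a hyperplane a · x = β with a₀ ≠ 0 are affinely dependent, and
-- a₀ x₀ = β - Σ_{e>0} aₑ xₑ carries the dependency over to coordinate 0.
hyperplane⇒affinelyDependent : (a : Vecℚ (suc d)) (β : ℚ) → ¬ a zero ≡ 0ℚ → suc d ℕ.< k →
  (p : Fin k → Vecℚ (suc d)) → (∀ i → dot a (p i) ≡ β) → AffinelyDependent p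
hyperplane⇒affinelyDependent a β a₀≢0 d+1<k p p∈H
  with 1+d<k⇒affinelyDependent d+1<k (λ i e → p i (suc e))
... | c , Σc≡0 , comb≡0 , i , cᵢ≢0 = c , Σc≡0 , comb≡0′ , i , cᵢ≢0
  where
  comb : Vecℚ (suc _)
  comb e = Σℚ (λ i → c i * p i e)

  a₀*comb₀≡0 : a zero * comb zero ≡ 0ℚ
  a₀*comb₀≡0 = begin
    a zero * comb zero                              ≡⟨ +-identityʳ _ ⟨
    a zero * comb zero + 0ℚ                         ≡⟨ cong (a zero * comb zero +_)
                                                         (Σℚ-zero (λ e → trans (cong (a (suc e) *_) (comb≡0 e))
                                                                                (*-zeroʳ (a (suc e))))) ⟨
    dot a comb                                      ≡⟨ dot-combination a c p ⟩
    Σℚ (λ i → c i * dot a (p i))                    ≡⟨ Σℚ-cong (λ i → cong (c i *_) (p∈H i)) ⟩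
    Σℚ (λ i → c i * β)                              ≡⟨ Σℚ-*ʳ β c ⟩
    Σℚ c * β                                        ≡⟨ cong (_* β) Σc≡0 ⟩
    0ℚ * β                                          ≡⟨ *-zeroˡ β ⟩
    0ℚ                                              ∎
    where open ≡-Reasoning

  comb≡0′ : ∀ e → comb e ≡ 0ℚ
  comb≡0′ zero    = *-cancelˡ-≡0 a₀≢0 a₀*comb₀≡0
  comb≡0′ (suc e) = comb≡0 e

edge-endpoints : {A : Set} {Z : A → Set} {x : A × A} {v w : A} →
  Z (proj₁ x) × Z (proj₂ x) → (x ≡ (v , w)) ⊎ (x ≡ (w , v)) → Z v × Z w
edge-endpoints (z₁ , z₂) (inj₁ refl) = z₁ , z₂
edge-endpoints (z₁ , z₂) (inj₂ refl) = z₂ , z₁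

sameComp-within : {G : Graph} {δ : EdgeSet G} (Z : Fin (nV G) → Set) →
  (∀ e → δ e ≡ false → Z (proj₁ (ends G e)) × Z (proj₂ (ends G e))) →
  ∀ {u w} → SameComp G δ u w → w ≡ u ⊎ (Z u × Z w)
sameComp-within Z closed here = inj₁ refl
sameComp-within Z closed (step u~v e δₑ≡false v—w)
  with sameComp-within Z closed u~v | edge-endpoints {Z = Z} (closed e δₑ≡false) v—w
... | inj₁ refl      | z-u , z-w = inj₂ (z-u , z-w)
... | inj₂ (z-u , _) | _   , z-w = inj₂ (z-u , z-w)

incidence-cong : (G : Graph) {δ δ′ : EdgeSet G} → (∀ e → δ e ≡ δ′ e) →
  ∀ e → incidence G δ e ≡ incidence G δ′ e
incidence-cong G δ≗δ′ e = cong (λ b → if b then 1ℚ else 0ℚ) (δ≗δ′ e)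

multicut∈MultCbox : {G : Graph} {S : Terminals G} {δ : EdgeSet G} →
  IsMulticut G S δ → MultCbox G S (incidence G δ)
multicut∈MultCbox {δ = δ} multicut =
  1 , (λ _ → 1ℚ) , (λ _ → δ) , (λ _ → 0≤1) , +-identityʳ 1ℚ , (λ _ → multicut) ,
  λ e → sym (trans (+-identityʳ _) (*-identityˡ _))

MultCbox⊆MultC : {G : Graph} {S : Terminals G} {x : Vecℚ (nE G)} → MultCbox G S x → MultC G S x
MultCbox⊆MultC x∈box = _ , x∈box , λ _ → ≤-refl

MultCbox-valid : {G : Graph} {S : Terminals G} (a : Vecℚ (nE G)) (β : ℚ) →
  (∀ δ → IsMulticut G S δ → β ≤ dot a (incidence G δ)) → ∀ x → MultCbox G S x → β ≤ dot a x
MultCbox-valid {G} a β valid x (k , λs , δs , λ≥0 , Σλ≡1 , multicut , x≡comb) = begin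
  β                                                     ≡⟨ trans (sym (*-identityˡ β)) (cong (_* β) (sym Σλ≡1)) ⟩
  Σℚ λs * β                                             ≡⟨ Σℚ-*ʳ β λs ⟨
  Σℚ (λ i → λs i * β)                                   ≤⟨ Σℚ-mono-≤ (λ i → λᵢβ≤λᵢ·δᵢ i) ⟩
  Σℚ (λ i → λs i * dot a (incidence G (δs i)))          ≡⟨ dot-combination a λs (incidence G ∘ δs) ⟨
  dot a (λ e → Σℚ (λ i → λs i * incidence G (δs i) e))  ≡⟨ dot-cong a (sym ∘ x≡comb) ⟩
  dot a x                                               ∎
  where
  open ≤-Reasoning
  λᵢβ≤λᵢ·δᵢ : ∀ i → λs i * β ≤ λs i * dot a (incidence G (δs i))
  λᵢβ≤λᵢ·δᵢ i = *-monoˡ-≤-nonNeg (λs i) {{nonNegative (λ≥0 i)}} (valid (δs i) (multicut i))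

MultC-valid : {G : Graph} {S : Terminals G} (a : Vecℚ (nE G)) (β : ℚ) → (∀ e → 0ℚ ≤ a e) →
  (∀ x → MultCbox G S x → β ≤ dot a x) → ∀ x → MultC G S x → β ≤ dot a x
MultC-valid a β a≥0 box-valid x (y , y∈box , y≤x) =
  ≤-trans (box-valid y y∈box) (Σℚ-mono-≤ (λ e → *-monoˡ-≤-nonNeg (a e) {{nonNegative (a≥0 e)}} (y≤x e)))

AtMostOneUncut : {G : Graph} → EdgeSet G → Set
AtMostOneUncut {G} δ = ∀ (e e′ : Fin (nE G)) → δ e ≡ false → δ e′ ≡ false → e ≡ e′

leaves-connected : (δ : EdgeSet (star n)) {e e′ : Fin n} →
  δ e ≡ false → δ e′ ≡ false → SameComp (star n) δ (suc e) (suc e′)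
leaves-connected δ δₑ δₑ′ = step (step here _ δₑ (inj₂ refl)) _ δₑ′ (inj₁ refl)

star-multicut⇒atMostOneUncut : (δ : EdgeSet (star n)) →
  IsMulticut (star n) (starTerminals n) δ → AtMostOneUncut {star n} δ
star-multicut⇒atMostOneUncut δ multicut e e′ δₑ δₑ′ with <-cmp e e′
... | tri< e<e′ _ _ = contradiction (leaves-connected δ δₑ δₑ′) (multicut _ _ (e , e′ , e<e′ , refl , refl))
... | tri≈ _ e≡e′ _ = e≡e′
... | tri> _ _ e′<e = contradiction (leaves-connected δ δₑ′ δₑ) (multicut _ _ (e′ , e , e′<e , refl , refl))

atMostOneUncut⇒star-multicut : (δ : EdgeSet (star n)) →
  AtMostOneUncut {star n} δ → IsMulticut (star n) (starTerminals n) δ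
atMostOneUncut⇒star-multicut {n} δ atMostOne _ _ (i , j , i<j , refl , refl) vᵢ~vⱼ
  with sameComp-within Z closed vᵢ~vⱼ
  where
  -- the centre together with the leaves whose edge is not cut
  Z : Fin (suc n) → Set
  Z x = ∀ a → x ≡ suc a → δ a ≡ false
  closed : ∀ e → δ e ≡ false → Z zero × Z (suc e)
  closed e δₑ = (λ _ ()) , λ a x≡vₐ → subst (λ b → δ b ≡ false) (suc-injective x≡vₐ) δₑ
... | inj₁ vⱼ≡vᵢ    = <⇒≢ i<j (sym (suc-injective vⱼ≡vᵢ))
... | inj₂ (zᵢ , zⱼ) = <⇒≢ i<j (atMostOne i j (zᵢ i refl) (zⱼ j refl))

allBut : Fin n → EdgeSet (star n)
allBut i e = not (does (i ≟ e))

allBut-false : ∀ (i e : Fin n) → allBut i e ≡ false → i ≡ e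
allBut-false i e allBut≡false with i ≟ e
... | yes i≡e = i≡e
... | no  _   with () ← allBut≡false

allBut-sym : ∀ (i e : Fin n) → allBut i e ≡ allBut e i
allBut-sym i e with i ≟ e | e ≟ i
... | yes _   | yes _   = refl
... | no  _   | no  _   = refl
... | yes i≡e | no  e≢i = contradiction (sym i≡e) e≢i
... | no  i≢e | yes e≡i = contradiction (sym e≡i) i≢e

allBut-multicut : (i : Fin n) → IsMulticut (star n) (starTerminals n) (allBut i)
allBut-multicut i = atMostOneUncut⇒star-multicut (allBut i)
  λ e e′ δₑ δₑ′ → trans (sym (allBut-false i e δₑ)) (allBut-false i e′ δₑ′)

allEdges-multicut : IsMulticut (star n) (starTerminals n) (λ _ → true)
allEdges-multicut = atMostOneUncut⇒star-multicut (λ _ → true) λ _ _ ()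

atMostOneUncut⇒allEdges⊎allBut : (δ : EdgeSet (star n)) → AtMostOneUncut {star n} δ →
  (∀ e → δ e ≡ true) ⊎ ∃ λ i → ∀ e → δ e ≡ allBut i e
atMostOneUncut⇒allEdges⊎allBut δ atMostOne with any? (λ i → δ i ≟ᵇ false)
... | no  ∄uncut        = inj₁ λ e → ¬-not λ δₑ → ∄uncut (e , δₑ)
... | yes (i , δᵢ≡false) = inj₂ (i , uncut-only-i)
  where
  uncut-only-i : ∀ e → δ e ≡ allBut i e
  uncut-only-i e with i ≟ e
  ... | yes refl = δᵢ≡false
  ... | no  i≢e  = ¬-not λ δₑ → i≢e (atMostOne i e δᵢ≡false δₑ)

Σℚ-allBut : (c : Fin n → ℚ) (i : Fin n) →
  Σℚ (λ e → c e * incidence (star n) (allBut i) e) + c i ≡ Σℚ c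
Σℚ-allBut {suc n} c zero    = begin
  c zero * 0ℚ + Σℚ (λ e → c (suc e) * 1ℚ) + c zero
    ≡⟨ cong (λ s → c zero * 0ℚ + s + c zero) (Σℚ-cong (λ e → *-identityʳ (c (suc e)))) ⟩
  c zero * 0ℚ + Σℚ (c ∘ suc) + c zero
    ≡⟨ solve 2 (λ c₀ s → c₀ :* con 0ℚ :+ s :+ c₀ := c₀ :+ s) refl (c zero) (Σℚ (c ∘ suc)) ⟩
  Σℚ c
    ∎
  where open ≡-Reasoning
Σℚ-allBut {suc n} c (suc i) = begin
  c zero * 1ℚ + S + c (suc i)
    ≡⟨ solve 3 (λ c₀ s cᵢ → c₀ :* con 1ℚ :+ s :+ cᵢ := c₀ :+ (s :+ cᵢ)) refl (c zero) S (c (suc i)) ⟩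
  c zero + (S + c (suc i))
    ≡⟨ cong (c zero +_) (Σℚ-allBut (c ∘ suc) i) ⟩
  Σℚ c
    ∎
  where
  open ≡-Reasoning
  S = Σℚ (λ e → c (suc e) * incidence (star n) (allBut i) e)

faceVertex : Fin n → Vecℚ n
faceVertex i = incidence (star _) (allBut i)

vertex : Fin (suc n) → Vecℚ n
vertex zero    = incidence (star _) (λ _ → true)
vertex (suc i) = faceVertex i

Σℚ-faceVertex : (c : Fin n → ℚ) (e : Fin n) → Σℚ (λ i → c i * faceVertex i e) + c e ≡ Σℚ c
Σℚ-faceVertex c e =
  trans (cong (_+ c e) (Σℚ-cong (λ i → cong (λ b → c i * (if b then 1ℚ else 0ℚ)) (allBut-sym i e))))
        (Σℚ-allBut c e)

faceVertex-affIndep : AffIndep (faceVertex {n})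
faceVertex-affIndep c Σc≡0 comb≡0 e = begin
  c e                                        ≡⟨ +-identityˡ (c e) ⟨
  0ℚ + c e                                   ≡⟨ cong (_+ c e) (comb≡0 e) ⟨
  Σℚ (λ i → c i * faceVertex i e) + c e      ≡⟨ Σℚ-faceVertex c e ⟩
  Σℚ c                                       ≡⟨ Σc≡0 ⟩
  0ℚ                                         ∎
  where open ≡-Reasoning

vertex-affIndep : AffIndep (vertex {n})
vertex-affIndep c Σc≡0 comb≡0 zero    = begin
  c zero                     ≡⟨ solve 2 (λ c₀ s → c₀ := c₀ :+ s :- s) refl (c zero) (Σℚ (c ∘ suc)) ⟩
  Σℚ c - Σℚ (c ∘ suc)        ≡⟨ cong₂ _-_ Σc≡0 (Σℚ-zero (vertex-affIndep c Σc≡0 comb≡0 ∘ suc)) ⟩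
  0ℚ                         ∎
  where open ≡-Reasoning
vertex-affIndep c Σc≡0 comb≡0 (suc e) = begin
  c (suc e)
    ≡⟨ solve 3 (λ c₀ t cₑ → cₑ := c₀ :+ (t :+ cₑ) :- (c₀ :* con 1ℚ :+ t)) refl (c zero) T (c (suc e)) ⟩
  c zero + (T + c (suc e)) - (c zero * 1ℚ + T)
    ≡⟨ cong₂ (λ s t → c zero + s - t) (Σℚ-faceVertex (c ∘ suc) e) (comb≡0 e) ⟩
  Σℚ c - 0ℚ
    ≡⟨ cong (_- 0ℚ) Σc≡0 ⟩
  0ℚ
    ∎
  where
  open ≡-Reasoning
  T = Σℚ (λ i → c (suc i) * faceVertex i e)

dot-faceVertex : (i : Fin n) → dot (λ _ → 1ℚ) (faceVertex i) ≡ nMinus1 n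
dot-faceVertex {n} i = begin
  D                 ≡⟨ solve 1 (λ x → x := x :+ con 1ℚ :- con 1ℚ) refl D ⟩
  D + 1ℚ - 1ℚ       ≡⟨ cong (_- 1ℚ) (trans (Σℚ-allBut (λ _ → 1ℚ) i) (Σℚ-1 n)) ⟩
  nMinus1 n         ∎
  where
  open ≡-Reasoning
  D = dot (λ _ → 1ℚ) (faceVertex i)

star-multicut-valid : (δ : EdgeSet (star n)) → IsMulticut (star n) (starTerminals n) δ →
  nMinus1 n ≤ dot (λ _ → 1ℚ) (incidence (star n) δ)
star-multicut-valid {n} δ multicut
  with atMostOneUncut⇒allEdges⊎allBut δ (star-multicut⇒atMostOneUncut δ multicut)
... | inj₁ allEdges = ≤-trans (nMinus1≤n n) (≤-reflexive (sym (begin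
  dot (λ _ → 1ℚ) (incidence (star n) δ)          ≡⟨ dot-cong (λ _ → 1ℚ) (incidence-cong (star n) allEdges) ⟩
  Σℚ {n} (λ _ → 1ℚ * 1ℚ)                         ≡⟨ Σℚ-cong {n} (λ _ → *-identityˡ 1ℚ) ⟩
  Σℚ {n} (λ _ → 1ℚ)                              ≡⟨ Σℚ-1 n ⟩
  ℤ.+ n / 1                                      ∎)))
  where open ≡-Reasoning
... | inj₂ (i , δ≗allBut) = ≤-reflexive (sym
  (trans (dot-cong (λ _ → 1ℚ) (incidence-cong (star n) δ≗allBut)) (dot-faceVertex i)))

vertex∈MultCbox : (i : Fin (suc n)) → MultCbox (star n) (starTerminals n) (vertex i)
vertex∈MultCbox zero    = multicut∈MultCbox allEdges-multicut
vertex∈MultCbox (suc i) = multicut∈MultCbox (allBut-multicut i)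

face-¬HasAffIndep : (P : PointSet n) → ¬ HasAffIndep (Face P (λ _ → 1ℚ) (nMinus1 n)) (suc n)
-- In ℚ⁰ every dot product is 0, while nMinus1 0 = -1: the face is empty.
face-¬HasAffIndep {zero}  P (p , p∈face , _) with () ← proj₂ (p∈face zero)
face-¬HasAffIndep {suc n} P (p , p∈face , indep) = affinelyDependent⇒¬AffIndep {p = p}
  (hyperplane⇒affinelyDependent (λ _ → 1ℚ) (nMinus1 (suc n)) (λ ()) ℕ.≤-refl p (proj₂ ∘ p∈face)) indep

star-facet : (P : PointSet n) → (∀ x → P x → nMinus1 n ≤ dot (λ _ → 1ℚ) x) → (∀ i → P (vertex i)) →
  FacetDefining P (λ _ → 1ℚ) (nMinus1 n)
star-facet {n} P valid vertex∈P =
  valid , n ,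
  ((faceVertex , (λ i → vertex∈P (suc i) , dot-faceVertex i) , faceVertex-affIndep) , face-¬HasAffIndep P) ,
  ((vertex , vertex∈P , vertex-affIndep) ,
   λ (p , _ , indep) → affinelyDependent⇒¬AffIndep {p = p} (1+d<k⇒affinelyDependent ℕ.≤-refl p) indep)

theorem5p3 : (n : ℕ) →
    SharedFacet (star n) (starTerminals n) (λ e → 1ℚ) (nMinus1 n)
theorem5p3 n =
    star-facet (MultC (star n) (starTerminals n))
      (MultC-valid (λ _ → 1ℚ) (nMinus1 n) (λ _ → 0≤1) box-valid) (MultCbox⊆MultC ∘ vertex∈MultCbox)
  , star-facet (MultCbox (star n) (starTerminals n)) box-valid vertex∈MultCbox
  where
  box-valid : ∀ x → MultCbox (star n) (starTerminals n) x → nMinus1 n ≤ dot (λ _ → 1ℚ) x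
  box-valid = MultCbox-valid (λ _ → 1ℚ) (nMinus1 n) star-multicut-valid
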